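{- Let $G^g,G'^{g'},G''^{g''}$ be games with activeness with $G''^{g''}\in G'^{g'}\in G^g$. If $G^g=G''^{g''}$, then $G^g=((G\setminus\{G'^{g'}\})\cup G'')^g$.
   Context: Let $\mathcal{B}=\{0,1\}$. Define $\mathbb{I}_0=\{\emptyset\}\times\mathcal{B}$ and $\mathbb{I}_n=2^{\mathbb{I}_{n-1}}\times\mathcal{B}$ for $n\ge1$; a game with activeness is an element of $\mathbb{I}=\bigcup_{n\ge0}\mathbb{I}_n$. A pair $(G,g)$ is written $G^g$; elements of $G$ are its options (written $G'^{g'}\in G^g$), $g=1$ meaning active. The outcome $o$ is defined recursively: $o(G^g)=\mathscr{N}$ if $g=1$ and some option has outcome $\mathscr{P}$, and $o(G^g)=\mathscr{P}$ otherwise. The sum is $G^g+H^h=(\{G'^{g'}+H^h:G'^{g'}\in G^g\}\cup\{G^g+H'^{h'}:H'^{h'}\in H^h\})^{\max\{g,h\}}$. $G^g=H^h$ means $o(G^g+X^x)=o(H^h+X^x)$ for all games $X^x$. -}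

module Defs where

open import Data.Bool using (Bool; true; false; _∧_; _∨_; not)
open import Data.List using (List; []; _∷_; _++_)
open import Data.List.Relation.Unary.All using (All)
open import Data.List.Relation.Unary.Any using (Any)
open import Data.Product using (_×_)
open import Relation.Binary.PropositionalEquality using (_≡_)

-- Hereditarily finite sets are represented by finite
-- trees (lists of options); set-theoretic equality of games is the
-- extensional relation _≈_ below.
data Game : Set where
  mk : List Game → Bool → Game

options : Game → List Game
options (mk xs _) = xs

activeness : Game → Bool
activeness (mk _ g) = g

data _≈_ : Game → Game → Set where
  ext : ∀ {xs ys g} →
        All (λ x → Any (λ y → x ≈ y) ys) xs →
        All (λ y → Any (λ x → x ≈ y) xs) ys →
        mk xs g ≈ mk ys g

_∈ᵍ_ : Game → Game → Set
X ∈ᵍ G = Any (λ Y → X ≈ Y) (options G)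

data Outcome : Set where
  𝒩 𝒫 : Outcome

mutual
  o : Game → Outcome
  o (mk xs g) with g ∧ someP xs
  ... | true  = 𝒩
  ... | false = 𝒫

  someP : List Game → Bool
  someP []       = false
  someP (x ∷ xs) = isP x ∨ someP xs

  isP : Game → Bool
  isP (mk xs g) = not (g ∧ someP xs)

mutual
  _+ᵍ_ : Game → Game → Game
  mk xs g +ᵍ mk ys h = mk (sumL xs (mk ys h) ++ sumR (mk xs g) ys) (g ∨ h)

  sumL : List Game → Game → List Game
  sumL []       H = []
  sumL (x ∷ xs) H = (x +ᵍ H) ∷ sumL xs H

  sumR : Game → List Game → List Game
  sumR G []       = []
  sumR G (y ∷ ys) = (G +ᵍ y) ∷ sumR G ys

_≐_ : Game → Game → Set
G ≐ H = ∀ X → o (G +ᵍ X) ≡ o (H +ᵍ X)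

-- By induction on X, G + X and K + X are 𝒫-positions together (H = G″). If G + X is an
-- 𝒩-position, so is H + X; its 𝒫-option is either H′ + X with H′ also an option of K, or
-- H + X′ = G + X′ = K + X′ by induction. Conversely a 𝒫-option K′ + X of K + X has K′ an option
-- of G or of H; in the latter case H + X, hence G + X, is an 𝒩-position, because a game equal
-- to an active game is itself active.

module Submission where

open import Defs
open import Data.Product using (_×_)
open import Data.Sum using (_⊎_)
open import Relation.Nullary using (¬_)
open import Relation.Binary.PropositionalEquality using (_≡_)

open import Data.Bool using (Bool; true; false; _∧_; _∨_)
open import Data.List using ([]; _∷_; map)
open import Data.List.Membership.Propositional using (find)
open import Data.List.Relation.Unary.All as All using (All; []; _∷_)
open import Data.List.Relation.Unary.Any as Any using (Any; here; there)
open import Data.List.Relation.Unary.Any.Properties using (map⁺; map⁻; ++⁺ˡ; ++⁺ʳ; ++⁻)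
open import Data.Product using (∃; _,_; proj₁; proj₂)
open import Data.Sum using (inj₁; inj₂)
import Data.Sum as Sum
open import Function using (id; const)
open import Function.Bundles using (_⇔_; mk⇔; Equivalence)
open import Relation.Binary.PropositionalEquality using (refl; sym; trans; cong)
open import Relation.Nullary using (contradiction)

open Equivalence using (to; from)

module _ {ℓ} (P : Game → Set ℓ) (step : ∀ xs x → All P xs → P (mk xs x)) where
  mutual
    Game-ind : ∀ X → P X
    Game-ind (mk xs x) = step xs x (Game-ind-options xs)

    Game-ind-options : ∀ xs → All P xs
    Game-ind-options []       = []
    Game-ind-options (y ∷ ys) = Game-ind y ∷ Game-ind-options ys

Any-map-All : ∀ {A : Set} {P Q : A → Set} {xs} → All (λ x → P x → Q x) xs → Any P xs → Any Q xs
Any-map-All (f ∷ _)  (here p)  = here (f p)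
Any-map-All (_ ∷ fs) (there p) = there (Any-map-All fs p)

All-diagonal : ∀ {A : Set} {R : A → A → Set} {xs} → All (λ x → R x x) xs → All (λ x → Any (R x) xs) xs
All-diagonal rs = All.tabulate λ x∈xs → Any.map (λ { refl → All.lookup rs x∈xs }) x∈xs

bool-ext : ∀ {a b : Bool} → (a ≡ false → b ≡ false) → (b ≡ false → a ≡ false) → a ≡ b
bool-ext {false} {false} _ _ = refl
bool-ext {false} {true}  f _ with () ← f refl
bool-ext {true}  {false} _ g with () ← g refl
bool-ext {true}  {true}  _ _ = refl

≈-refl : ∀ A → A ≈ A
≈-refl = Game-ind (λ A → A ≈ A) λ _ _ rs → ext (All-diagonal rs) (All-diagonal {R = λ x y → y ≈ x} rs)

∈ᵍ-find : ∀ {P : Game → Set} {A} → Any P (options A) → ∃ λ A′ → A′ ∈ᵍ A × P A′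
∈ᵍ-find p with find p
... | A′ , A′∈A , pA′ = A′ , Any.map (λ { refl → ≈-refl A′ }) A′∈A , pA′

IsP : Game → Set
IsP A = isP A ≡ true

someP≡true⇔ : ∀ {xs} → someP xs ≡ true ⇔ Any IsP xs
someP≡true⇔ = mk⇔ someP⇒ someP⇐
  where
  someP⇒ : ∀ {xs} → someP xs ≡ true → Any IsP xs
  someP⇒ {x ∷ xs} e with isP x in x-P
  ... | true  = here x-P
  ... | false = there (someP⇒ e)

  someP⇐ : ∀ {xs} → Any IsP xs → someP xs ≡ true
  someP⇐ (here x-P) rewrite x-P = refl
  someP⇐ {x ∷ _} (there p) rewrite someP⇐ p with isP x
  ... | true  = refl
  ... | false = refl

isP≡false⇔ : ∀ {xs g} → isP (mk xs g) ≡ false ⇔ (g ≡ true × Any IsP xs)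
isP≡false⇔ {xs} {g} = mk⇔ ⇒ ⇐
  where
  ⇒ : ∀ {g} → isP (mk xs g) ≡ false → g ≡ true × Any IsP xs
  ⇒ {true} n with someP xs in some
  ... | true = refl , someP≡true⇔ .to some

  ⇐ : ∀ {g} → g ≡ true × Any IsP xs → isP (mk xs g) ≡ false
  ⇐ (refl , p) rewrite someP≡true⇔ .from p = refl

sumL≡map : ∀ xs H → sumL xs H ≡ map (_+ᵍ H) xs
sumL≡map []       H = refl
sumL≡map (x ∷ xs) H = cong (x +ᵍ H ∷_) (sumL≡map xs H)

sumR≡map : ∀ G ys → sumR G ys ≡ map (G +ᵍ_) ys
sumR≡map G []       = refl
sumR≡map G (y ∷ ys) = cong (G +ᵍ y ∷_) (sumR≡map G ys)

Any-sumL⇔ : ∀ {P : Game → Set} xs H → Any P (sumL xs H) ⇔ Any (λ x → P (x +ᵍ H)) xs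
Any-sumL⇔ xs H rewrite sumL≡map xs H = mk⇔ map⁻ map⁺

Any-sumR⇔ : ∀ {P : Game → Set} G ys → Any P (sumR G ys) ⇔ Any (λ y → P (G +ᵍ y)) ys
Any-sumR⇔ G ys rewrite sumR≡map G ys = mk⇔ map⁻ map⁺

isP-+≡false⇔ : ∀ G X → isP (G +ᵍ X) ≡ false ⇔
  (activeness G ∨ activeness X ≡ true ×
   (Any (λ G′ → IsP (G′ +ᵍ X)) (options G) ⊎ Any (λ X′ → IsP (G +ᵍ X′)) (options X)))
isP-+≡false⇔ (mk gs g) (mk xs x) = mk⇔ ⇒ ⇐
  where
  G+X = mk gs g +ᵍ mk xs x
  Options-P = Any (λ G′ → IsP (G′ +ᵍ mk xs x)) gs ⊎ Any (λ X′ → IsP (mk gs g +ᵍ X′)) xs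

  ⇒ : isP G+X ≡ false → g ∨ x ≡ true × Options-P
  ⇒ n with isP≡false⇔ .to n
  ... | active , p with ++⁻ (sumL gs (mk xs x)) p
  ...   | inj₁ left  = active , inj₁ (Any-sumL⇔ gs (mk xs x) .to left)
  ...   | inj₂ right = active , inj₂ (Any-sumR⇔ (mk gs g) xs .to right)

  ⇐ : g ∨ x ≡ true × Options-P → isP G+X ≡ false
  ⇐ (active , inj₁ left)  = isP≡false⇔ .from (active , ++⁺ˡ (Any-sumL⇔ gs (mk xs x) .from left))
  ⇐ (active , inj₂ right) =
    isP≡false⇔ .from (active , ++⁺ʳ (sumL gs (mk xs x)) (Any-sumR⇔ (mk gs g) xs .from right))

isP-+-mono : ∀ {as a bs b xs x} →
  (a ∨ x ≡ true → b ∨ x ≡ true) →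
  (Any (λ A′ → IsP (A′ +ᵍ mk xs x)) as → Any (λ B′ → IsP (B′ +ᵍ mk xs x)) bs) →
  All (λ X′ → isP (mk as a +ᵍ X′) ≡ isP (mk bs b +ᵍ X′)) xs →
  isP (mk as a +ᵍ mk xs x) ≡ false → isP (mk bs b +ᵍ mk xs x) ≡ false
isP-+-mono {as} {a} {bs} {b} {xs} {x} active⇒ left⇒ right≡ n
  with isP-+≡false⇔ (mk as a) (mk xs x) .to n
... | active , inj₁ left  =
  isP-+≡false⇔ (mk bs b) (mk xs x) .from (active⇒ active , inj₁ (left⇒ left))
... | active , inj₂ right =
  isP-+≡false⇔ (mk bs b) (mk xs x) .from
    (active⇒ active , inj₂ (Any-map-All (All.map (λ e → trans (sym e)) right≡) right))

infix 4 _≐ᵖ_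

_≐ᵖ_ : Game → Game → Set
G ≐ᵖ H = ∀ X → isP (G +ᵍ X) ≡ isP (H +ᵍ X)

≈⇒≐ᵖ : ∀ A {B} → A ≈ B → A ≐ᵖ B
≈⇒≐ᵖ = Game-ind (λ A → ∀ {B} → A ≈ B → A ≐ᵖ B) step
  where
  step : ∀ as a → All (λ A′ → ∀ {B′} → A′ ≈ B′ → A′ ≐ᵖ B′) as → ∀ {B} → mk as a ≈ B → mk as a ≐ᵖ B
  step as a ih {mk bs .a} (ext as⊆bs bs⊆as) = Game-ind _ λ xs x ih-X →
    bool-ext (isP-+-mono id (left⇒ (mk xs x)) ih-X)
             (isP-+-mono id (left⇐ (mk xs x)) (All.map sym ih-X))
    where
    left⇒ : ∀ X → Any (λ A′ → IsP (A′ +ᵍ X)) as → Any (λ B′ → IsP (B′ +ᵍ X)) bs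
    left⇒ X = All.lookupWith
      (λ (ih-A′ , A′∈bs) A′-P → Any.map (λ A′≈B′ → trans (sym (ih-A′ A′≈B′ X)) A′-P) A′∈bs)
      (All.zip (ih , as⊆bs))

    left⇐ : ∀ X → Any (λ B′ → IsP (B′ +ᵍ X)) bs → Any (λ A′ → IsP (A′ +ᵍ X)) as
    left⇐ X = All.lookupWith
      (λ B′∈as B′-P → Any-map-All (All.map (λ ih-A′ A′≈B′ → trans (ih-A′ A′≈B′ X) B′-P) ih) B′∈as)
      bs⊆as

∈ᵍ-IsP : ∀ {A′ B} X → A′ ∈ᵍ B → IsP (A′ +ᵍ X) → Any (λ B′ → IsP (B′ +ᵍ X)) (options B)
∈ᵍ-IsP X A′∈B A′-P = Any.map (λ A′≈B′ → trans (sym (≈⇒≐ᵖ _ A′≈B′ X)) A′-P) A′∈B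

⊆-IsP : ∀ {A B} X → (∀ Y → Y ∈ᵍ A → Y ∈ᵍ B) →
  Any (λ A′ → IsP (A′ +ᵍ X)) (options A) → Any (λ B′ → IsP (B′ +ᵍ X)) (options B)
⊆-IsP {A} {B} X A⊆B p with ∈ᵍ-find {A = A} p
... | A′ , A′∈A , A′-P = ∈ᵍ-IsP {B = B} X (A⊆B A′ A′∈A) A′-P

-- Distinguished by Y = {0⁰}⁰: G + 0⁰ is a 𝒫-position (as H + 0⁰ is inactive), so the active G + Y
-- is an 𝒩-position, while H + Y is inactive.
active≢ᵖinactive : ∀ {gs hs} → ¬ (mk gs true ≐ᵖ mk hs false)
active≢ᵖinactive {gs} eq = contradiction (trans (sym (eq Y)) G+Y-N) λ ()
  where
  0⁰ Y : Game
  0⁰ = mk [] false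
  Y  = mk (0⁰ ∷ []) false
  G+Y-N : isP (mk gs true +ᵍ Y) ≡ false
  G+Y-N = isP-+≡false⇔ (mk gs true) Y .from (refl , inj₂ (here (eq 0⁰)))

≐ᵖ-active : ∀ {gs g hs h} x → mk gs g ≐ᵖ mk hs h → g ∨ x ≡ true → h ∨ x ≡ true
≐ᵖ-active {h = true}                _     _  _ = refl
≐ᵖ-active {h = false}               true  _  _ = refl
≐ᵖ-active {g = true}  {h = false}   false eq _ = contradiction eq active≢ᵖinactive
≐ᵖ-active {g = false} {h = false}   false _  ()

replace-options : ∀ G H K → G ≐ᵖ H → activeness K ≡ activeness G →
  (∀ Y → Y ∈ᵍ K → Y ∈ᵍ G ⊎ Y ∈ᵍ H) → (∀ Y → Y ∈ᵍ H → Y ∈ᵍ K) → G ≐ᵖ K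
replace-options (mk gs g) (mk hs h) (mk ks .g) G≐H refl K⊆G∪H H⊆K =
  Game-ind _ λ xs x ih-X → bool-ext (N-G⇒N-K xs x ih-X) (N-K⇒N-G xs x ih-X)
  where
  G H K : Game
  G = mk gs g
  H = mk hs h
  K = mk ks g

  N-G⇒N-K : ∀ xs x → All (λ X′ → isP (G +ᵍ X′) ≡ isP (K +ᵍ X′)) xs →
            isP (G +ᵍ mk xs x) ≡ false → isP (K +ᵍ mk xs x) ≡ false
  N-G⇒N-K xs x ih-X n =
    isP-+-mono (const (proj₁ (isP-+≡false⇔ G (mk xs x) .to n))) (⊆-IsP {H} {K} (mk xs x) H⊆K)
               (All.map (λ {X′} e → trans (sym (G≐H X′)) e) ih-X) (trans (sym (G≐H (mk xs x))) n)

  N-K⇒N-G : ∀ xs x → All (λ X′ → isP (G +ᵍ X′) ≡ isP (K +ᵍ X′)) xs →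
            isP (K +ᵍ mk xs x) ≡ false → isP (G +ᵍ mk xs x) ≡ false
  N-K⇒N-G xs x ih-X n with isP-+≡false⇔ K (mk xs x) .to n
  ... | active , inj₂ right =
    isP-+≡false⇔ G (mk xs x) .from (active , inj₂ (Any-map-All (All.map trans ih-X) right))
  ... | active , inj₁ left with ∈ᵍ-find {A = K} left
  ...   | K′ , K′∈K , K′-P with K⊆G∪H K′ K′∈K
  ...     | inj₁ K′∈G =
    isP-+≡false⇔ G (mk xs x) .from (active , inj₁ (∈ᵍ-IsP {B = G} (mk xs x) K′∈G K′-P))
  ...     | inj₂ K′∈H = trans (G≐H (mk xs x)) (isP-+≡false⇔ H (mk xs x) .from
    (≐ᵖ-active x G≐H active , inj₁ (∈ᵍ-IsP {B = H} (mk xs x) K′∈H K′-P)))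

outcome : Bool → Outcome
outcome true  = 𝒫
outcome false = 𝒩

o≡outcome∘isP : ∀ A → o A ≡ outcome (isP A)
o≡outcome∘isP (mk xs g) with g ∧ someP xs
... | true  = refl
... | false = refl

outcome-injective : ∀ {a b} → outcome a ≡ outcome b → a ≡ b
outcome-injective {false} {false} _ = refl
outcome-injective {true}  {true}  _ = refl

o≡⇔isP≡ : ∀ A B → o A ≡ o B ⇔ isP A ≡ isP B
o≡⇔isP≡ A B rewrite o≡outcome∘isP A | o≡outcome∘isP B = mk⇔ outcome-injective (cong outcome)

≐⇔≐ᵖ : ∀ G H → G ≐ H ⇔ G ≐ᵖ H
≐⇔≐ᵖ G H = mk⇔ (λ G≐H X → o≡⇔isP≡ (G +ᵍ X) (H +ᵍ X) .to (G≐H X))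
                (λ G≐H X → o≡⇔isP≡ (G +ᵍ X) (H +ᵍ X) .from (G≐H X))

theorem3p38 : (G G′ G″ : Game) → G″ ∈ᵍ G′ → G′ ∈ᵍ G → G ≐ G″ →
    (K : Game) → activeness K ≡ activeness G →
    (∀ X → (X ∈ᵍ K → (X ∈ᵍ G × ¬ (X ≈ G′)) ⊎ X ∈ᵍ G″)
    × ((X ∈ᵍ G × ¬ (X ≈ G′)) ⊎ X ∈ᵍ G″ → X ∈ᵍ K)) →
    G ≐ K
theorem3p38 G _ G″ _ _ G≐G″ K K-active K-options =
  ≐⇔≐ᵖ G K .from (replace-options G G″ K (≐⇔≐ᵖ G G″ .to G≐G″) K-active K⊆G∪G″ G″⊆K)
  where
  K⊆G∪G″ : ∀ Y → Y ∈ᵍ K → Y ∈ᵍ G ⊎ Y ∈ᵍ G″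
  K⊆G∪G″ Y Y∈K = Sum.map₁ proj₁ (proj₁ (K-options Y) Y∈K)

  G″⊆K : ∀ Y → Y ∈ᵍ G″ → Y ∈ᵍ K
  G″⊆K Y Y∈G″ = proj₂ (K-options Y) (inj₂ Y∈G″)
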